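{- Let $G$ be a $(P_5, K_1\cup K_3)$-free graph containing a $5$-hole $C=v_1v_2v_3v_4v_5v_1$. Then for each $i\in\{1,\dots,5\}$ (indices modulo $5$): (a) $N_{\{i,i+1,i+2\}}(C)=N_{\{i,i+1,i+2,i+3\}}(C)=\emptyset$. (b) Both $N_{\{i,i+2\}}(C)$ and $N_{\{i,i+1,i+3\}}(C)$ are independent, and $N_{\{i,i+2\}}(C)$ is complete to $N_{\{i+1,i+3\}}(C)\cup N_{\{i+1,i+4\}}(C)$. (c) $\mathcal{N}^{(2)}(C)$ is complete to $N_{\{1,2,3,4,5\}}(C)$, and $\mathcal{N}^{(3)}(C)$ is complete to $M(C)$. (d) $N_{\{i,i+1,i+3\}}(C)$ is anticomplete to $N_{\{i,i+3\}}(C)\cup N_{\{i+1,i+3\}}(C)$. Moreover, if $M(C)\neq\emptyset$, then $N_{\{i,i+1,i+3\}}(C)$ is anticomplete to $N_{\{i,i+2,i+3\}}(C)\cup N_{\{i+1,i+3,i+4\}}(C)$, and is either complete or anticomplete to $N_{\{i-1,i,i+2\}}(C)\cup N_{\{i+1,i+2,i+4\}}(C)$ whenever both $N_{\{i-1,i,i+2\}}(C)$ and $N_{\{i+1,i+2,i+4\}}(C)$ are nonempty. (e) If $\omega(G[N_{\{1,2,3,4,5\}}(C)])=\omega(G)-2$ or $M(C)\neq\emptyset$, then $G[V(C)\cup\mathcal{N}^{(2)}(C)]$ is a $5$-ring.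
   Context: All graphs are finite and simple; $(P_5,K_1\cup K_3)$-free means no induced path on five vertices and no induced disjoint union of a vertex and a triangle. A $5$-hole is an induced cycle of length $5$. For a $5$-hole $C=v_1\cdots v_5v_1$: $N(C)$ is the set of vertices outside $V(C)$ with a neighbor in $V(C)$; $M(C)=V(G)\setminus(V(C)\cup N(C))$; for $T\subseteq\{1,\dots,5\}$, $N_T(C)=\{x\in N(C): xv_j\in E(G)\text{ iff } j\in T\}$; $\mathcal{N}^{(2)}(C)=\bigcup_{j} N_{\{j,j+2\}}(C)$; $\mathcal{N}^{(3)}(C)=\bigcup_j (N_{\{j,j+1,j+2\}}(C)\cup N_{\{j,j+1,j+3\}}(C))$. $X$ is complete (anticomplete) to $Y$ if every vertex of $X$ is adjacent (non-adjacent) to every vertex of $Y$. A $5$-ring is a blow up of a $5$-hole, i.e. a graph obtained from a $5$-cycle by replacing each vertex with a nonempty independent set and each edge with a complete bipartite graph. $\omega$ denotes clique number. -}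

module Defs where

open import Data.Nat using (ℕ; zero; suc; _+_; _∸_; _≤_)
open import Data.Nat.DivMod using (_%_; m%n<n)
open import Data.Fin using (Fin; toℕ; fromℕ<; zero)
open import Data.List using (List; []; _∷_; length)
open import Data.List.Membership.Propositional using (_∈_)
open import Data.List.Relation.Unary.All using (All)
open import Data.List.Relation.Unary.AllPairs using (AllPairs)
open import Data.Product using (Σ; ∃; ∃-syntax; _×_; _,_)
open import Data.Sum using (_⊎_)
open import Data.Unit using (⊤)
open import Data.Empty using (⊥)
open import Function.Bundles using (_⇔_)
open import Function.Definitions using (Injective)
open import Relation.Nullary using (¬_; Dec)
open import Relation.Binary.PropositionalEquality using (_≡_; _≢_)

record Graph : Set₁ where
  field
    n       : ℕ
    _~_     : Fin n → Fin n → Set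
    ~-sym   : ∀ {x y} → x ~ y → y ~ x
    ~-irr   : ∀ {x} → ¬ (x ~ x)
    ~-dec   : ∀ x y → Dec (x ~ y)

open Graph public

V : Graph → Set
V G = Fin (n G)

_⊕_ : Fin 5 → ℕ → Fin 5
i ⊕ k = fromℕ< (m%n<n (toℕ i + k) 5)

InducedP5 : (G : Graph) → (Fin 5 → V G) → Set
InducedP5 G f = Injective _≡_ _≡_ f ×
  (∀ i j → (_~_ G (f i) (f j)) ⇔ (toℕ j ≡ suc (toℕ i) ⊎ toℕ i ≡ suc (toℕ j)))

P5Free : Graph → Set
P5Free G = ∀ f → ¬ InducedP5 G f

InducedK1K3 : (G : Graph) → V G → V G → V G → V G → Set
InducedK1K3 G a b c d =
  (a ≢ b × a ≢ c × a ≢ d × b ≢ c × b ≢ d × c ≢ d) ×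
  (_~_ G b c × _~_ G b d × _~_ G c d) ×
  (¬ _~_ G a b × ¬ _~_ G a c × ¬ _~_ G a d)

K1K3Free : Graph → Set
K1K3Free G = ∀ a b c d → ¬ InducedK1K3 G a b c d

-- 5-holes: C = c 0 · c 1 · c 2 · c 3 · c 4 · c 0  (v_{k+1} = c k)

IsHole5 : (G : Graph) → (Fin 5 → V G) → Set
IsHole5 G c = Injective _≡_ _≡_ c ×
  (∀ i j → (_~_ G (c i) (c j)) ⇔ (j ≡ i ⊕ 1 ⊎ i ≡ j ⊕ 1))

module HoleNotions (G : Graph) (c : Fin 5 → V G) where

  OnC : V G → Set
  OnC x = ∃[ j ] x ≡ c j

  InNC : V G → Set
  InNC x = ¬ OnC x × ∃[ j ] _~_ G x (c j)

  InM : V G → Set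
  InM x = ¬ OnC x × (∀ j → ¬ _~_ G x (c j))

  InN : List (Fin 5) → V G → Set
  InN T x = InNC x × (∀ j → (_~_ G x (c j)) ⇔ (j ∈ T))

  InN2 : V G → Set
  InN2 x = ∃[ j ] InN (j ∷ j ⊕ 2 ∷ []) x

  InN3 : V G → Set
  InN3 x = ∃[ j ] (InN (j ∷ j ⊕ 1 ∷ j ⊕ 2 ∷ []) x ⊎ InN (j ∷ j ⊕ 1 ∷ j ⊕ 3 ∷ []) x)

  N12345 : V G → Set
  N12345 = InN (zero ⊕ 0 ∷ zero ⊕ 1 ∷ zero ⊕ 2 ∷ zero ⊕ 3 ∷ zero ⊕ 4 ∷ [])

module SetNotions (G : Graph) where

  _∪_ : (V G → Set) → (V G → Set) → V G → Set
  (X ∪ Y) x = X x ⊎ Y x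

  IsEmpty : (V G → Set) → Set
  IsEmpty X = ∀ x → ¬ X x

  NonEmpty : (V G → Set) → Set
  NonEmpty X = ∃[ x ] X x

  Independent : (V G → Set) → Set
  Independent X = ∀ x y → X x → X y → ¬ _~_ G x y

  Complete : (V G → Set) → (V G → Set) → Set
  Complete X Y = ∀ x y → X x → Y y → _~_ G x y

  Anticomplete : (V G → Set) → (V G → Set) → Set
  Anticomplete X Y = ∀ x y → X x → Y y → ¬ _~_ G x y

  HasClique : (V G → Set) → ℕ → Set
  HasClique X k = Σ (List (V G)) λ xs →
    length xs ≡ k × All X xs × AllPairs (λ x y → x ≢ y × _~_ G x y) xs

  CliqueNumber : (V G → Set) → ℕ → Set
  CliqueNumber X k = HasClique X k × (∀ m → HasClique X m → m ≤ k)

  -- G[X] is a 5-ring (blow-up of a 5-hole): X is partitioned into five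
  -- nonempty parts A_0..A_4 (A_j = vertices of X with part j) such that
  -- two vertices of X are adjacent iff their parts are consecutive mod 5
  -- (so parts are independent, consecutive parts complete,
  --  non-consecutive parts anticomplete)
  IsFiveRing : (V G → Set) → Set
  IsFiveRing X = Σ (V G → Fin 5) λ part →
    (∀ j → ∃[ x ] (X x × part x ≡ j)) ×
    (∀ x y → X x → X y →
      (_~_ G x y) ⇔ (part y ≡ part x ⊕ 1 ⊎ part x ≡ part y ⊕ 1))

-- The conclusion of Lemma 2.1, for a graph G and a 5-hole c
-- (v_{k} of the paper is c (k-1); the paper's index i ∈ {1..5} is i ∈ Fin 5,
--  N_{i,...} with paper indices shifts uniformly, so statements are unchanged)

module _ (G : Graph) (c : Fin 5 → V G) where
  open HoleNotions G c
  open SetNotions G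

  PartA : Fin 5 → Set
  PartA i = IsEmpty (InN (i ∷ i ⊕ 1 ∷ i ⊕ 2 ∷ [])) ×
            IsEmpty (InN (i ∷ i ⊕ 1 ∷ i ⊕ 2 ∷ i ⊕ 3 ∷ []))

  PartB : Fin 5 → Set
  PartB i = Independent (InN (i ∷ i ⊕ 2 ∷ [])) ×
            Independent (InN (i ∷ i ⊕ 1 ∷ i ⊕ 3 ∷ [])) ×
            Complete (InN (i ∷ i ⊕ 2 ∷ []))
                     (InN (i ⊕ 1 ∷ i ⊕ 3 ∷ []) ∪ InN (i ⊕ 1 ∷ i ⊕ 4 ∷ []))

  PartC : Set
  PartC = Complete InN2 N12345 × Complete InN3 InM

  PartD : Fin 5 → Set
  PartD i =
    Anticomplete (InN (i ∷ i ⊕ 1 ∷ i ⊕ 3 ∷ []))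
                 (InN (i ∷ i ⊕ 3 ∷ []) ∪ InN (i ⊕ 1 ∷ i ⊕ 3 ∷ [])) ×
    (NonEmpty InM →
      Anticomplete (InN (i ∷ i ⊕ 1 ∷ i ⊕ 3 ∷ []))
                   (InN (i ∷ i ⊕ 2 ∷ i ⊕ 3 ∷ []) ∪ InN (i ⊕ 1 ∷ i ⊕ 3 ∷ i ⊕ 4 ∷ [])) ×
      (NonEmpty (InN (i ⊕ 4 ∷ i ∷ i ⊕ 2 ∷ [])) →
       NonEmpty (InN (i ⊕ 1 ∷ i ⊕ 2 ∷ i ⊕ 4 ∷ [])) →
         Complete (InN (i ∷ i ⊕ 1 ∷ i ⊕ 3 ∷ []))
                  (InN (i ⊕ 4 ∷ i ∷ i ⊕ 2 ∷ []) ∪ InN (i ⊕ 1 ∷ i ⊕ 2 ∷ i ⊕ 4 ∷ []))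
         ⊎
         Anticomplete (InN (i ∷ i ⊕ 1 ∷ i ⊕ 3 ∷ []))
                  (InN (i ⊕ 4 ∷ i ∷ i ⊕ 2 ∷ []) ∪ InN (i ⊕ 1 ∷ i ⊕ 2 ∷ i ⊕ 4 ∷ []))))

  PartE : Set
  PartE =
    ((Σ ℕ λ k → Σ ℕ λ w →
        CliqueNumber N12345 k × CliqueNumber (λ _ → ⊤) w × k ≡ w ∸ 2)
     ⊎ NonEmpty InM) →
    IsFiveRing (OnC ∪ InN2)

-- Rotating the hole, v_j ↦ v_{j+i}, carries N_T(C) to N_{T+i}(C), so every statement indexed by i
-- is proved once, for i = 0 (the paper's v_1), where each is witnessed by a single induced P5 or
-- K1 ∪ K3 on vertices of the hole and the vertices in question.  The dichotomy in (d) is in fact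
-- always resolved as "complete", by such a P5.  For (e), a vertex of N_{a,a+2}(C) joins the part of
-- v_{a+1}.  By (b) each part is independent and consecutive parts are complete.  An edge between
-- N_{a,a+2}(C) and N_{a+2,a+4}(C) is excluded either by an induced P5 or K1 ∪ K3 through a vertex of
-- M(C), or, since both its ends and v_{a+2} are complete to N_{1,...,5}(C) by (c), because it would
-- extend a maximum clique of G[N_{1,...,5}(C)] to a clique of size ω(G) + 1.
module Submission where

open import Defs
open import Data.Fin using (Fin; toℕ) renaming (_≟_ to _≟ᶠ_)
open import Data.Fin.Patterns using (0F; 1F; 2F; 3F; 4F)
open import Data.Fin.Properties using (all?; any?)
open import Data.Nat using (ℕ; suc; _+_; _∸_; _≤_; s≤s) renaming (_≟_ to _≟ⁿ_)
open import Data.Nat.Properties using (1+n≰n)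
open import Data.Unit using (⊤; tt)
open import Data.Empty using (⊥; ⊥-elim)
open import Data.Product using (Σ; ∃-syntax; _×_; _,_; proj₁; proj₂)
open import Data.Sum using (_⊎_; inj₁; inj₂; [_,_]′) renaming (swap to ⊎-swap)
open import Data.List using (List; []; _∷_; map)
open import Data.List.Relation.Unary.Any using (here; there)
open import Data.List.Membership.Propositional using (_∈_)
open import Data.List.Membership.Propositional.Properties using (∈-map⁺; ∈-map⁻)
open import Data.List.Membership.DecPropositional (_≟ᶠ_ {5}) using (_∈?_)
open import Data.List.Relation.Unary.All using (_∷_; tabulate) renaming (map to All-map)
open import Data.List.Relation.Unary.AllPairs using (_∷_)
open import Function using (_∘_; id)
open import Function.Bundles using (_⇔_; mk⇔; Equivalence)
open import Relation.Nullary using (¬_; Dec; yes; no)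
open import Relation.Nullary.Decidable using (_×-dec_; _⊎-dec_; _→-dec_; ¬?; True; False; toWitness; toWitnessFalse; from-yes; decidable-stable)
open import Relation.Unary using (_⊆_)
open import Relation.Binary.PropositionalEquality using (_≡_; refl; sym; trans; cong; subst; _≢_)

open Equivalence using (to; from)

both : ∀ {A B : Set} → A → B → A ⇔ B
both a b = mk⇔ (λ _ → b) (λ _ → a)

neither : ∀ {A B : Set} → ¬ A → ¬ B → A ⇔ B
neither ¬a ¬b = mk⇔ (⊥-elim ∘ ¬a) (⊥-elim ∘ ¬b)

Consecutive : Fin 5 → Fin 5 → Set
Consecutive i j = j ≡ i ⊕ 1 ⊎ i ≡ j ⊕ 1

consecutive? : ∀ i j → Dec (Consecutive i j)
consecutive? i j = j ≟ᶠ i ⊕ 1 ⊎-dec i ≟ᶠ j ⊕ 1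

Consecutive-irrefl : ∀ i → ¬ Consecutive i i
Consecutive-irrefl = from-yes (all? λ i → ¬? (consecutive? i i))

offset-cases : ∀ a b → b ≡ a ⊎ b ≡ a ⊕ 1 ⊎ a ≡ b ⊕ 1 ⊎ b ≡ a ⊕ 2 ⊎ a ≡ b ⊕ 2
offset-cases = from-yes (all? λ a → all? λ b →
  b ≟ᶠ a ⊎-dec b ≟ᶠ a ⊕ 1 ⊎-dec a ≟ᶠ b ⊕ 1 ⊎-dec b ≟ᶠ a ⊕ 2 ⊎-dec a ≟ᶠ b ⊕ 2)

[i⊕1]⊕2≡i⊕3 : ∀ i → (i ⊕ 1) ⊕ 2 ≡ i ⊕ 3
[i⊕1]⊕2≡i⊕3 = from-yes (all? λ i → (i ⊕ 1) ⊕ 2 ≟ᶠ i ⊕ 3)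

[i⊕2]⊕2≡i⊕4 : ∀ i → (i ⊕ 2) ⊕ 2 ≡ i ⊕ 4
[i⊕2]⊕2≡i⊕4 = from-yes (all? λ i → (i ⊕ 2) ⊕ 2 ≟ᶠ i ⊕ 4)

shift : Fin 5 → Fin 5 → Fin 5
shift i j = i ⊕ toℕ j

shift-identityʳ : ∀ i → shift i 0F ≡ i
shift-identityʳ = from-yes (all? λ i → shift i 0F ≟ᶠ i)

shift-injective : ∀ i {j k} → shift i j ≡ shift i k → j ≡ k
shift-injective i {j} {k} = from-yes (all? λ i → all? λ j → all? λ k →
  shift i j ≟ᶠ shift i k →-dec j ≟ᶠ k) i j k

shift-surjective : ∀ i k → ∃[ j ] shift i j ≡ k
shift-surjective = from-yes (all? λ i → all? λ k → any? λ j → shift i j ≟ᶠ k)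

shift-preserves-consecutive : ∀ i {j k} → Consecutive j k → Consecutive (shift i j) (shift i k)
shift-preserves-consecutive i {j} {k} = from-yes (all? λ i → all? λ j → all? λ k →
  consecutive? j k →-dec consecutive? (shift i j) (shift i k)) i j k

shift-reflects-consecutive : ∀ i {j k} → Consecutive (shift i j) (shift i k) → Consecutive j k
shift-reflects-consecutive i {j} {k} = from-yes (all? λ i → all? λ j → all? λ k →
  consecutive? (shift i j) (shift i k) →-dec consecutive? j k) i j k

∈-indices : ∀ (j : Fin 5) → j ∈ (0F ∷ 1F ∷ 2F ∷ 3F ∷ 4F ∷ [])
∈-indices 0F = here refl
∈-indices 1F = there (here refl)
∈-indices 2F = there (there (here refl))
∈-indices 3F = there (there (there (here refl)))
∈-indices 4F = there (there (there (there (here refl))))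

PathAdjacent : Fin 5 → Fin 5 → Set
PathAdjacent i j = toℕ j ≡ suc (toℕ i) ⊎ toℕ i ≡ suc (toℕ j)

pathAdjacent? : ∀ i j → Dec (PathAdjacent i j)
pathAdjacent? i j = toℕ j ≟ⁿ suc (toℕ i) ⊎-dec toℕ i ≟ⁿ suc (toℕ j)

path-twin-free : ∀ i j → i ≡ j ⊎ ∃[ k ] (PathAdjacent i k × ¬ PathAdjacent j k
                                        ⊎ ¬ PathAdjacent i k × PathAdjacent j k)
path-twin-free = from-yes (all? λ i → all? λ j → i ≟ᶠ j ⊎-dec any? λ k →
  pathAdjacent? i k ×-dec ¬? (pathAdjacent? j k) ⊎-dec ¬? (pathAdjacent? i k) ×-dec pathAdjacent? j k)

⊕2-pair-unique : ∀ {a b} → b ∈ (a ∷ a ⊕ 2 ∷ []) → b ⊕ 2 ∈ (a ∷ a ⊕ 2 ∷ []) → b ≡ a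
⊕2-pair-unique {a} {b} = from-yes (all? λ a → all? λ b →
  b ∈? (a ∷ a ⊕ 2 ∷ []) →-dec b ⊕ 2 ∈? (a ∷ a ⊕ 2 ∷ []) →-dec b ≟ᶠ a) a b

∈-N2⇔Consecutive : ∀ j b → j ∈ (b ∷ b ⊕ 2 ∷ []) ⇔ Consecutive j (b ⊕ 1)
∈-N2⇔Consecutive j b = mk⇔ (proj₁ (decided j b)) (proj₂ (decided j b))
  where
  decided : ∀ j b → (j ∈ (b ∷ b ⊕ 2 ∷ []) → Consecutive j (b ⊕ 1)) ×
                    (Consecutive j (b ⊕ 1) → j ∈ (b ∷ b ⊕ 2 ∷ []))
  decided = from-yes (all? λ j → all? λ b →
    (j ∈? (b ∷ b ⊕ 2 ∷ []) →-dec consecutive? j (b ⊕ 1)) ×-dec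
    (consecutive? j (b ⊕ 1) →-dec j ∈? (b ∷ b ⊕ 2 ∷ [])))

N2-far-not-Consecutive : ∀ a → ¬ Consecutive (a ⊕ 1) ((a ⊕ 2) ⊕ 1)
N2-far-not-Consecutive = from-yes (all? λ a → ¬? (consecutive? (a ⊕ 1) ((a ⊕ 2) ⊕ 1)))

module Forbidden (G : Graph) where

  private
    _∼_ : V G → V G → Set
    _∼_ = _~_ G

  ∼⇒≢ : ∀ {x y} → x ∼ y → x ≢ y
  ∼⇒≢ x∼y refl = ~-irr G x∼y

  ≁-sym : ∀ {x y} → ¬ x ∼ y → ¬ y ∼ x
  ≁-sym x≁y = x≁y ∘ ~-sym G

  ∼-≁⇒≢ : ∀ {x y z} → x ∼ z → ¬ y ∼ z → x ≢ y
  ∼-≁⇒≢ x∼z y≁z refl = y≁z x∼z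

  no-induced-K1∪K3 : K1K3Free G → ∀ {a b d e} → b ∼ d → b ∼ e → d ∼ e →
                     ¬ b ∼ a → ¬ d ∼ a → ¬ e ∼ a → ⊥
  no-induced-K1∪K3 k13 b∼d b∼e d∼e b≁a d≁a e≁a = k13 _ _ _ _
    ( ( ∼-≁⇒≢ b∼d (≁-sym d≁a) ∘ sym , ∼-≁⇒≢ (~-sym G b∼d) (≁-sym b≁a) ∘ sym
      , ∼-≁⇒≢ (~-sym G b∼e) (≁-sym b≁a) ∘ sym
      , ∼⇒≢ b∼d , ∼⇒≢ b∼e , ∼⇒≢ d∼e )
    , (b∼d , b∼e , d∼e)
    , (≁-sym b≁a , ≁-sym d≁a , ≁-sym e≁a) )

  path-adjacency⇒injective : (g : Fin 5 → V G) → (∀ i j → g i ∼ g j ⇔ PathAdjacent i j) →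
                             ∀ {i j} → g i ≡ g j → i ≡ j
  path-adjacency⇒injective g adj {i} {j} gi≡gj with path-twin-free i j
  ... | inj₁ i≡j = i≡j
  ... | inj₂ (k , inj₁ (ik , ¬jk)) =
    ⊥-elim (¬jk (to (adj j k) (subst (λ v → v ∼ g k) gi≡gj (from (adj i k) ik))))
  ... | inj₂ (k , inj₂ (¬ik , jk)) =
    ⊥-elim (¬ik (to (adj i k) (subst (λ v → v ∼ g k) (sym gi≡gj) (from (adj j k) jk))))

  no-induced-P5 : P5Free G → ∀ {a b d e f} → a ∼ b → b ∼ d → d ∼ e → e ∼ f →
                   ¬ a ∼ d → ¬ a ∼ e → ¬ a ∼ f → ¬ b ∼ e → ¬ b ∼ f → ¬ d ∼ f → ⊥
  no-induced-P5 p5 {a} {b} {d} {e} {f} a∼b b∼d d∼e e∼f a≁d a≁e a≁f b≁e b≁f d≁f =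
    p5 g (path-adjacency⇒injective g adj , adj)
    where
    g : Fin 5 → V G
    g 0F = a
    g 1F = b
    g 2F = d
    g 3F = e
    g 4F = f

    edge : ∀ {i j} → g i ∼ g j → {True (pathAdjacent? i j)} → g i ∼ g j ⇔ PathAdjacent i j
    edge {i} {j} gi∼gj {p} = mk⇔ (λ _ → toWitness p) (λ _ → gi∼gj)

    non : ∀ {i j} → ¬ g i ∼ g j → {False (pathAdjacent? i j)} → g i ∼ g j ⇔ PathAdjacent i j
    non {i} {j} gi≁gj {p} = mk⇔ (⊥-elim ∘ gi≁gj) (⊥-elim ∘ toWitnessFalse p)

    flip : ∀ {i j} → g j ∼ g i ⇔ PathAdjacent j i → g i ∼ g j ⇔ PathAdjacent i j
    flip eq = mk⇔ (⊎-swap ∘ to eq ∘ ~-sym G) (~-sym G ∘ from eq ∘ ⊎-swap)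

    adj : ∀ i j → g i ∼ g j ⇔ PathAdjacent i j
    adj 0F 0F = non (~-irr G)
    adj 0F 1F = edge a∼b
    adj 0F 2F = non a≁d
    adj 0F 3F = non a≁e
    adj 0F 4F = non a≁f
    adj 1F 1F = non (~-irr G)
    adj 1F 2F = edge b∼d
    adj 1F 3F = non b≁e
    adj 1F 4F = non b≁f
    adj 2F 2F = non (~-irr G)
    adj 2F 3F = edge d∼e
    adj 2F 4F = non d≁f
    adj 3F 3F = non (~-irr G)
    adj 3F 4F = edge e∼f
    adj 4F 4F = non (~-irr G)
    adj 1F 0F = flip (adj 0F 1F)
    adj 2F 0F = flip (adj 0F 2F)
    adj 2F 1F = flip (adj 1F 2F)
    adj 3F 0F = flip (adj 0F 3F)
    adj 3F 1F = flip (adj 1F 3F)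
    adj 3F 2F = flip (adj 2F 3F)
    adj 4F 0F = flip (adj 0F 4F)
    adj 4F 1F = flip (adj 1F 4F)
    adj 4F 2F = flip (adj 2F 4F)
    adj 4F 3F = flip (adj 3F 4F)

module Cliques (G : Graph) where
  open SetNotions G
  open Forbidden G using (∼⇒≢)

  private
    _∼_ : V G → V G → Set
    _∼_ = _~_ G

    distinct : ∀ {x y} → x ∼ y → x ≢ y × x ∼ y
    distinct x∼y = ∼⇒≢ x∼y , x∼y

  triangle-extends-clique : ∀ {X k x y z} → HasClique X k → x ∼ y → x ∼ z → y ∼ z →
    (∀ v → X v → x ∼ v) → (∀ v → X v → y ∼ v) → (∀ v → X v → z ∼ v) →
    HasClique (λ _ → ⊤) (3 + k)
  triangle-extends-clique (xs , refl , inX , pairwise) x∼y x∼z y∼z x∼X y∼X z∼X =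
    _ ∷ _ ∷ _ ∷ xs , refl , tabulate (λ _ → tt) ,
    (distinct x∼y ∷ distinct x∼z ∷ All-map (distinct ∘ x∼X _) inX) ∷
    (distinct y∼z ∷ All-map (distinct ∘ y∼X _) inX) ∷
    All-map (distinct ∘ z∼X _) inX ∷ pairwise

  3+[n∸2]≰n : ∀ n → ¬ 3 + (n ∸ 2) ≤ n
  3+[n∸2]≰n 0 ()
  3+[n∸2]≰n 1 (s≤s ())
  3+[n∸2]≰n (suc (suc n)) (s≤s (s≤s 3+n≤n)) = 1+n≰n 3+n≤n

  clique-gap-forbids-triangle : ∀ {X k w x y z} → CliqueNumber X k → CliqueNumber (λ _ → ⊤) w → k ≡ w ∸ 2 →
    x ∼ y → x ∼ z → y ∼ z → (∀ v → X v → x ∼ v) → (∀ v → X v → y ∼ v) → (∀ v → X v → z ∼ v) → ⊥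
  clique-gap-forbids-triangle {w = w} (clique , _) (_ , maximal) refl x∼y x∼z y∼z x∼X y∼X z∼X =
    3+[n∸2]≰n w (maximal _ (triangle-extends-clique clique x∼y x∼z y∼z x∼X y∼X z∼X))

module SetFacts (G : Graph) where
  open SetNotions G

  IsEmpty-antimono : ∀ {X Y} → X ⊆ Y → IsEmpty Y → IsEmpty X
  IsEmpty-antimono X⊆Y empty x = empty x ∘ X⊆Y

  Independent-antimono : ∀ {X Y} → X ⊆ Y → Independent Y → Independent X
  Independent-antimono X⊆Y indep x y hx hy = indep x y (X⊆Y hx) (X⊆Y hy)

  Complete-antimono : ∀ {X X′ Y Y′} → X′ ⊆ X → Y′ ⊆ Y → Complete X Y → Complete X′ Y′
  Complete-antimono X′⊆X Y′⊆Y complete x y hx hy = complete x y (X′⊆X hx) (Y′⊆Y hy)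

  Anticomplete-antimono : ∀ {X X′ Y Y′} → X′ ⊆ X → Y′ ⊆ Y → Anticomplete X Y → Anticomplete X′ Y′
  Anticomplete-antimono X′⊆X Y′⊆Y anticomplete x y hx hy = anticomplete x y (X′⊆X hx) (Y′⊆Y hy)

  Complete-∪ : ∀ {X Y Z} → Complete X Y → Complete X Z → Complete X (Y ∪ Z)
  Complete-∪ XY XZ x y hx = [ XY x y hx , XZ x y hx ]′

  Anticomplete-∪ : ∀ {X Y Z} → Anticomplete X Y → Anticomplete X Z → Anticomplete X (Y ∪ Z)
  Anticomplete-∪ XY XZ x y hx = [ XY x y hx , XZ x y hx ]′

module HoleFacts (G : Graph) (c : Fin 5 → V G) where
  open HoleNotions G c

  adjacent-∈ : ∀ {T x j} → InN T x → j ∈ T → _~_ G x (c j)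
  adjacent-∈ {j = j} hx = from (proj₂ hx j)

  adjacent : ∀ {T x} → InN T x → ∀ j → {True (j ∈? T)} → _~_ G x (c j)
  adjacent hx j {j∈T} = adjacent-∈ hx (toWitness j∈T)

  nonadjacent : ∀ {T x} → InN T x → ∀ j → {False (j ∈? T)} → ¬ _~_ G x (c j)
  nonadjacent hx j {j∉T} = toWitnessFalse j∉T ∘ to (proj₂ hx j)

  module _ (H : IsHole5 G c) where

    hole-edge : ∀ i j → {True (consecutive? i j)} → _~_ G (c i) (c j)
    hole-edge i j {p} = from (proj₂ H i j) (toWitness p)

    hole-nonedge : ∀ i j → {False (consecutive? i j)} → ¬ _~_ G (c i) (c j)
    hole-nonedge i j {p} = toWitnessFalse p ∘ to (proj₂ H i j)

module Rotation (G : Graph) (c : Fin 5 → V G) (H : IsHole5 G c) (i : Fin 5) where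

  c′ : Fin 5 → V G
  c′ = c ∘ shift i

  rotated-hole : IsHole5 G c′
  rotated-hole = shift-injective i ∘ proj₁ H , λ _ _ →
    mk⇔ (shift-reflects-consecutive i ∘ to (proj₂ H _ _)) (from (proj₂ H _ _) ∘ shift-preserves-consecutive i)

  private
    module C = HoleNotions G c
    module C′ = HoleNotions G c′

  rotate-OnC : ∀ {x} → ¬ C.OnC x → ¬ C′.OnC x
  rotate-OnC notOn (j , x≡c′j) = notOn (shift i j , x≡c′j)

  rotate-InM : ∀ {x} → C.InM x → C′.InM x
  rotate-InM (notOn , none) = rotate-OnC notOn , none ∘ shift i

  rotate : ∀ {T T′ x} → (∀ j → shift i j ∈ T′ ⇔ j ∈ T) → C.InN T′ x → C′.InN T x
  rotate {x = x} mem ((notOn , k , x∼ck) , adj) with shift-surjective i k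
  ... | j , refl = (rotate-OnC notOn , j , x∼ck) , λ j → mk⇔ (to (mem j) ∘ to (adj _)) (from (adj _) ∘ from (mem j))

  rotate-map : ∀ {T T′ x} → T′ ≡ map (shift i) T → C.InN T′ x → C′.InN T x
  rotate-map refl = rotate λ j → mk⇔ unmap (∈-map⁺ (shift i))
    where
    unmap : ∀ {j T} → shift i j ∈ map (shift i) T → j ∈ T
    unmap m with ∈-map⁻ (shift i) m
    ... | _ , k∈T , eq rewrite shift-injective i eq = k∈T

  rotate-N12345 : ∀ {x} → C.N12345 x → C′.N12345 x
  rotate-N12345 = rotate λ j → mk⇔ (λ _ → ∈-indices j) (λ _ → ∈-indices (shift i j))

  at-head : ∀ {T : List (Fin 5)} → i ∷ T ≡ shift i 0F ∷ T
  at-head = cong (_∷ _) (sym (shift-identityʳ i))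

module AtIndexZero (G : Graph) (p5 : P5Free G) (k13 : K1K3Free G)
                   (c : Fin 5 → V G) (H : IsHole5 G c) where
  open HoleNotions G c
  open SetNotions G
  open Forbidden G
  open HoleFacts G c

  private
    _∼_ : V G → V G → Set
    _∼_ = _~_ G

    ∼-sym : ∀ {x y} → x ∼ y → y ∼ x
    ∼-sym = ~-sym G

    edge : ∀ i j → {True (consecutive? i j)} → c i ∼ c j
    edge = hole-edge H

    nonedge : ∀ i j → {False (consecutive? i j)} → ¬ c i ∼ c j
    nonedge = hole-nonedge H

    by-contradiction : ∀ {x y} → (¬ x ∼ y → ⊥) → x ∼ y
    by-contradiction {x} {y} = decidable-stable (~-dec G x y)

  two-consecutive-neighbours⇒complete-M : ∀ {j k y w} → c j ∼ c k → y ∼ c j → y ∼ c k → InM w → y ∼ w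
  two-consecutive-neighbours⇒complete-M {j} {k} cj∼ck y∼cj y∼ck (_ , w≁C) =
    by-contradiction (no-induced-K1∪K3 k13 cj∼ck (∼-sym y∼cj) (∼-sym y∼ck) (≁-sym (w≁C j)) (≁-sym (w≁C k)))

  N012-empty : IsEmpty (InN (0F ∷ 1F ∷ 2F ∷ []))
  N012-empty x hx = no-induced-K1∪K3 k13 (edge 0F 1F) (∼-sym (adjacent hx 0F)) (∼-sym (adjacent hx 1F))
    (nonedge 0F 3F) (nonedge 1F 3F) (nonadjacent hx 3F)

  N0123-empty : IsEmpty (InN (0F ∷ 1F ∷ 2F ∷ 3F ∷ []))
  N0123-empty x hx = no-induced-K1∪K3 k13 (edge 1F 2F) (∼-sym (adjacent hx 1F)) (∼-sym (adjacent hx 2F))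
    (nonedge 1F 4F) (nonedge 2F 4F) (nonadjacent hx 4F)

  N02-independent : Independent (InN (0F ∷ 2F ∷ []))
  N02-independent x y hx hy x∼y = no-induced-K1∪K3 k13 x∼y (adjacent hx 0F) (adjacent hy 0F)
    (nonadjacent hx 3F) (nonadjacent hy 3F) (nonedge 0F 3F)

  N013-independent : Independent (InN (0F ∷ 1F ∷ 3F ∷ []))
  N013-independent x y hx hy x∼y = no-induced-K1∪K3 k13 x∼y (adjacent hx 0F) (adjacent hy 0F)
    (nonadjacent hx 2F) (nonadjacent hy 2F) (nonedge 0F 2F)

  N02-complete-N13 : Complete (InN (0F ∷ 2F ∷ [])) (InN (1F ∷ 3F ∷ []))
  N02-complete-N13 x y hx hy = by-contradiction λ x≁y → no-induced-P5 p5
    (∼-sym (adjacent hx 0F)) (adjacent hx 2F) (edge 2F 3F) (∼-sym (adjacent hy 3F))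
    (nonedge 0F 2F) (nonedge 0F 3F) (≁-sym (nonadjacent hy 0F)) (nonadjacent hx 3F) x≁y (≁-sym (nonadjacent hy 2F))

  N02-complete-N14 : Complete (InN (0F ∷ 2F ∷ [])) (InN (1F ∷ 4F ∷ []))
  N02-complete-N14 x y hx hy = by-contradiction λ x≁y → no-induced-P5 p5
    (∼-sym (adjacent hx 2F)) (adjacent hx 0F) (edge 0F 4F) (∼-sym (adjacent hy 4F))
    (nonedge 2F 0F) (nonedge 2F 4F) (≁-sym (nonadjacent hy 2F)) (nonadjacent hx 4F) x≁y (≁-sym (nonadjacent hy 0F))

  N02-complete-N12345 : Complete (InN (0F ∷ 2F ∷ [])) N12345
  N02-complete-N12345 x y hx hy = by-contradiction λ x≁y → no-induced-K1∪K3 k13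
    (edge 3F 4F) (∼-sym (adjacent hy 3F)) (∼-sym (adjacent hy 4F))
    (≁-sym (nonadjacent hx 3F)) (≁-sym (nonadjacent hx 4F)) (≁-sym x≁y)

  N013-complete-M : Complete (InN (0F ∷ 1F ∷ 3F ∷ [])) InM
  N013-complete-M x w hx = two-consecutive-neighbours⇒complete-M (edge 0F 1F) (adjacent hx 0F) (adjacent hx 1F)

  N013-anticomplete-N03 : Anticomplete (InN (0F ∷ 1F ∷ 3F ∷ [])) (InN (0F ∷ 3F ∷ []))
  N013-anticomplete-N03 x y hx hy x∼y = no-induced-K1∪K3 k13 x∼y (adjacent hx 0F) (adjacent hy 0F)
    (nonadjacent hx 2F) (nonadjacent hy 2F) (nonedge 0F 2F)

  N013-anticomplete-N13 : Anticomplete (InN (0F ∷ 1F ∷ 3F ∷ [])) (InN (1F ∷ 3F ∷ []))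
  N013-anticomplete-N13 x y hx hy x∼y = no-induced-K1∪K3 k13 x∼y (adjacent hx 1F) (adjacent hy 1F)
    (nonadjacent hx 4F) (nonadjacent hy 4F) (nonedge 1F 4F)

  N013-anticomplete-N023 : ∀ {w} → InM w → Anticomplete (InN (0F ∷ 1F ∷ 3F ∷ [])) (InN (0F ∷ 2F ∷ 3F ∷ []))
  N013-anticomplete-N023 hw x y hx hy x∼y = no-induced-K1∪K3 k13 x∼y
    (two-consecutive-neighbours⇒complete-M (edge 0F 1F) (adjacent hx 0F) (adjacent hx 1F) hw)
    (two-consecutive-neighbours⇒complete-M (edge 2F 3F) (adjacent hy 2F) (adjacent hy 3F) hw)
    (nonadjacent hx 4F) (nonadjacent hy 4F) (proj₂ hw 4F)

  N013-anticomplete-N134 : ∀ {w} → InM w → Anticomplete (InN (0F ∷ 1F ∷ 3F ∷ [])) (InN (1F ∷ 3F ∷ 4F ∷ []))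
  N013-anticomplete-N134 hw x y hx hy x∼y = no-induced-K1∪K3 k13 x∼y
    (two-consecutive-neighbours⇒complete-M (edge 0F 1F) (adjacent hx 0F) (adjacent hx 1F) hw)
    (two-consecutive-neighbours⇒complete-M (edge 3F 4F) (adjacent hy 3F) (adjacent hy 4F) hw)
    (nonadjacent hx 2F) (nonadjacent hy 2F) (proj₂ hw 2F)

  N013-complete-N402 : Complete (InN (0F ∷ 1F ∷ 3F ∷ [])) (InN (4F ∷ 0F ∷ 2F ∷ []))
  N013-complete-N402 x y hx hy = by-contradiction λ x≁y → no-induced-P5 p5
    (∼-sym (adjacent hx 1F)) (adjacent hx 3F) (edge 3F 4F) (∼-sym (adjacent hy 4F))
    (nonedge 1F 3F) (nonedge 1F 4F) (≁-sym (nonadjacent hy 1F)) (nonadjacent hx 4F) x≁y (≁-sym (nonadjacent hy 3F))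

  N013-complete-N124 : Complete (InN (0F ∷ 1F ∷ 3F ∷ [])) (InN (1F ∷ 2F ∷ 4F ∷ []))
  N013-complete-N124 x y hx hy = by-contradiction λ x≁y → no-induced-P5 p5
    (∼-sym (adjacent hx 0F)) (adjacent hx 3F) (edge 3F 2F) (∼-sym (adjacent hy 2F))
    (nonedge 0F 3F) (nonedge 0F 2F) (≁-sym (nonadjacent hy 0F)) (nonadjacent hx 2F) x≁y (≁-sym (nonadjacent hy 3F))

  N02-anticomplete-N24 : ∀ {w} → InM w → Anticomplete (InN (0F ∷ 2F ∷ [])) (InN (2F ∷ 4F ∷ []))
  N02-anticomplete-N24 {w} (_ , w≁C) x y hx hy x∼y = no-induced-K1∪K3 k13 x∼y (adjacent hx 2F) (adjacent hy 2F)
    (λ x∼w → no-induced-P5 p5 (edge 3F 4F) (edge 4F 0F) (∼-sym (adjacent hx 0F)) x∼w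
      (nonedge 3F 0F) (≁-sym (nonadjacent hx 3F)) (≁-sym (w≁C 3F)) (≁-sym (nonadjacent hx 4F))
      (≁-sym (w≁C 4F)) (≁-sym (w≁C 0F)))
    (λ y∼w → no-induced-P5 p5 (edge 0F 1F) (edge 1F 2F) (∼-sym (adjacent hy 2F)) y∼w
      (nonedge 0F 2F) (≁-sym (nonadjacent hy 0F)) (≁-sym (w≁C 0F)) (≁-sym (nonadjacent hy 1F))
      (≁-sym (w≁C 1F)) (≁-sym (w≁C 2F)))
    (≁-sym (w≁C 2F))

module Structure (G : Graph) (p5 : P5Free G) (k13 : K1K3Free G)
                 (c : Fin 5 → V G) (H : IsHole5 G c) where
  open HoleNotions G c
  open SetNotions G
  open SetFacts G
  open HoleFacts G c
  open Cliques G

  private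
    _∼_ : V G → V G → Set
    _∼_ = _~_ G

    ∼-sym : ∀ {x y} → x ∼ y → y ∼ x
    ∼-sym = ~-sym G

    module AtZero (i : Fin 5) = AtIndexZero G p5 k13 (c ∘ shift i) (Rotation.rotated-hole G c H i)
    module Rotated (i : Fin 5) = Rotation G c H i

    shifted : ∀ i {T} → InN (map (shift i) T) ⊆ HoleNotions.InN G (c ∘ shift i) T
    shifted i = Rotated.rotate-map i refl

    shifted-head : ∀ i {T} → InN (i ∷ map (shift i) T) ⊆ HoleNotions.InN G (c ∘ shift i) (0F ∷ T)
    shifted-head i = Rotated.rotate-map i (Rotated.at-head i)

  partA : ∀ i → PartA G c i
  partA i = IsEmpty-antimono (shifted-head i) (AtZero.N012-empty i) ,
            IsEmpty-antimono (shifted-head i) (AtZero.N0123-empty i)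

  partB : ∀ i → PartB G c i
  partB i = Independent-antimono (shifted-head i) (AtZero.N02-independent i) ,
            Independent-antimono (shifted-head i) (AtZero.N013-independent i) ,
            Complete-∪ (Complete-antimono (shifted-head i) (shifted i) (AtZero.N02-complete-N13 i))
                       (Complete-antimono (shifted-head i) (shifted i) (AtZero.N02-complete-N14 i))

  N2-complete-N12345 : Complete InN2 N12345
  N2-complete-N12345 x y (j , hx) hy = AtZero.N02-complete-N12345 j x y (shifted-head j hx) (Rotated.rotate-N12345 j hy)

  N3-complete-M : Complete InN3 InM
  N3-complete-M x w (j , inj₁ hx) = ⊥-elim (proj₁ (partA j) x hx)
  N3-complete-M x w (j , inj₂ hx) hw = AtZero.N013-complete-M j x w (shifted-head j hx) (Rotated.rotate-InM j hw)

  partC : PartC G c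
  partC = N2-complete-N12345 , N3-complete-M

  partD : ∀ i → PartD G c i
  partD i =
    Anticomplete-∪ (Anticomplete-antimono (shifted-head i) (shifted-head i) (AtZero.N013-anticomplete-N03 i))
                   (Anticomplete-antimono (shifted-head i) (shifted i) (AtZero.N013-anticomplete-N13 i)) ,
    λ (w , hw) →
      Anticomplete-∪ (Anticomplete-antimono (shifted-head i) (shifted-head i)
                                            (AtZero.N013-anticomplete-N023 i (Rotated.rotate-InM i hw)))
                     (Anticomplete-antimono (shifted-head i) (shifted i)
                                            (AtZero.N013-anticomplete-N134 i (Rotated.rotate-InM i hw))) ,
      λ _ _ → inj₁ (Complete-∪
        (Complete-antimono (shifted-head i) (Rotated.rotate-map i (cong (i ⊕ 4 ∷_) (Rotated.at-head i)))
                           (AtZero.N013-complete-N402 i))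
        (Complete-antimono (shifted-head i) (shifted i) (AtZero.N013-complete-N124 i)))

  OmegaGap : Set
  OmegaGap = Σ ℕ λ k → Σ ℕ λ w → CliqueNumber N12345 k × CliqueNumber (λ _ → ⊤) w × k ≡ w ∸ 2

  N2-far-anticomplete : OmegaGap ⊎ NonEmpty InM → ∀ a →
    Anticomplete (InN (a ∷ a ⊕ 2 ∷ [])) (InN (a ⊕ 2 ∷ (a ⊕ 2) ⊕ 2 ∷ []))
  N2-far-anticomplete (inj₁ (_ , _ , ωN , ωG , gap)) a x y hx hy x∼y =
    clique-gap-forbids-triangle ωN ωG gap x∼y (adjacent-∈ hx (there (here refl))) (adjacent-∈ hy (here refl))
      (λ v → N2-complete-N12345 x v (a , hx)) (λ v → N2-complete-N12345 y v (a ⊕ 2 , hy))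
      (λ v hv → ∼-sym (adjacent-∈ hv (∈-indices (a ⊕ 2))))
  N2-far-anticomplete (inj₂ (w , hw)) a =
    Anticomplete-antimono (shifted-head a)
      (Rotated.rotate-map a (cong (λ k → a ⊕ 2 ∷ k ∷ []) ([i⊕2]⊕2≡i⊕4 a)))
      (AtZero.N02-anticomplete-N24 a (Rotated.rotate-InM a hw))

  N2-complete-next : ∀ a → Complete (InN (a ∷ a ⊕ 2 ∷ [])) (InN (a ⊕ 1 ∷ (a ⊕ 1) ⊕ 2 ∷ []))
  N2-complete-next a x y hx hy = proj₂ (proj₂ (partB a)) x y hx
    (inj₁ (subst (λ k → InN (a ⊕ 1 ∷ k ∷ []) y) ([i⊕1]⊕2≡i⊕3 a) hy))

  private
    flip : ∀ {x y p q} → x ∼ y ⇔ Consecutive p q → y ∼ x ⇔ Consecutive q p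
    flip eq = mk⇔ (⊎-swap ∘ to eq ∘ ∼-sym) (∼-sym ∘ from eq ∘ ⊎-swap)

  N2-N2-adjacency : OmegaGap ⊎ NonEmpty InM → ∀ {a b x y} → InN (a ∷ a ⊕ 2 ∷ []) x → InN (b ∷ b ⊕ 2 ∷ []) y →
                    x ∼ y ⇔ Consecutive (a ⊕ 1) (b ⊕ 1)
  N2-N2-adjacency gap {a} {b} {x} {y} hx hy with offset-cases a b
  ... | inj₁ refl = neither (proj₁ (partB a) x y hx hy) (Consecutive-irrefl (a ⊕ 1))
  ... | inj₂ (inj₁ refl) = both (N2-complete-next a x y hx hy) (inj₁ refl)
  ... | inj₂ (inj₂ (inj₁ refl)) = flip (both (N2-complete-next b y x hy hx) (inj₁ refl))
  ... | inj₂ (inj₂ (inj₂ (inj₁ refl))) = neither (N2-far-anticomplete gap a x y hx hy) (N2-far-not-Consecutive a)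
  ... | inj₂ (inj₂ (inj₂ (inj₂ refl))) = flip (neither (N2-far-anticomplete gap b y x hy hx) (N2-far-not-Consecutive b))

  C-N2-adjacency : ∀ {j b y} → InN (b ∷ b ⊕ 2 ∷ []) y → c j ∼ y ⇔ Consecutive j (b ⊕ 1)
  C-N2-adjacency {j} {b} hy = mk⇔ (to (∈-N2⇔Consecutive j b) ∘ to (proj₂ hy j) ∘ ∼-sym)
                                  (∼-sym ∘ from (proj₂ hy j) ∘ from (∈-N2⇔Consecutive j b))

  private
    -- A vertex outside V(C) ∪ 𝒩^(2)(C) gets the junk position 0F.
    position : ∀ {x} → Dec (OnC x) → Dec (∃[ a ] (x ∼ c a × x ∼ c (a ⊕ 2))) → Fin 5
    position (yes (j , _)) _ = j
    position (no _) (yes (a , _)) = a ⊕ 1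
    position (no _) (no _) = 0F

    position-C : ∀ {x j} → x ≡ c j → ∀ on? n2? → position {x} on? n2? ≡ j
    position-C x≡cj (yes (k , x≡ck)) _ = proj₁ H (trans (sym x≡ck) x≡cj)
    position-C x≡cj (no notOn) _ = ⊥-elim (notOn (_ , x≡cj))

    position-N2 : ∀ {x a} → InN (a ∷ a ⊕ 2 ∷ []) x → ∀ on? n2? → position {x} on? n2? ≡ a ⊕ 1
    position-N2 hx (yes on) _ = ⊥-elim (proj₁ (proj₁ hx) on)
    position-N2 hx (no _) (yes (b , x∼cb , x∼cb⊕2)) =
      cong (_⊕ 1) (⊕2-pair-unique (to (proj₂ hx _) x∼cb) (to (proj₂ hx _) x∼cb⊕2))
    position-N2 {a = a} hx (no _) (no none) =
      ⊥-elim (none (a , adjacent-∈ hx (here refl) , adjacent-∈ hx (there (here refl))))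

    on? : ∀ x → Dec (OnC x)
    on? x = any? λ j → x ≟ᶠ c j

    N2-shaped? : ∀ x → Dec (∃[ a ] (x ∼ c a × x ∼ c (a ⊕ 2)))
    N2-shaped? x = any? λ a → ~-dec G x (c a) ×-dec ~-dec G x (c (a ⊕ 2))

  ring-position : V G → Fin 5
  ring-position x = position (on? x) (N2-shaped? x)

  ring-position-C : ∀ j → ring-position (c j) ≡ j
  ring-position-C j = position-C refl (on? (c j)) (N2-shaped? (c j))

  ring-position-N2 : ∀ {a x} → InN (a ∷ a ⊕ 2 ∷ []) x → ring-position x ≡ a ⊕ 1
  ring-position-N2 {x = x} hx = position-N2 hx (on? x) (N2-shaped? x)

  private
    reposition : ∀ {x y p p′ q q′} → p′ ≡ p → q′ ≡ q →
                 x ∼ y ⇔ Consecutive p q → x ∼ y ⇔ Consecutive p′ q′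
    reposition refl refl = id

  ring-adjacency : OmegaGap ⊎ NonEmpty InM → ∀ x y → (OnC ∪ InN2) x → (OnC ∪ InN2) y →
                   x ∼ y ⇔ Consecutive (ring-position x) (ring-position y)
  ring-adjacency gap _ _ (inj₁ (j , refl)) (inj₁ (k , refl)) =
    reposition (ring-position-C j) (ring-position-C k) (proj₂ H j k)
  ring-adjacency gap _ _ (inj₁ (j , refl)) (inj₂ (b , hy)) =
    reposition (ring-position-C j) (ring-position-N2 hy) (C-N2-adjacency hy)
  ring-adjacency gap _ _ (inj₂ (a , hx)) (inj₁ (k , refl)) =
    reposition (ring-position-N2 hx) (ring-position-C k) (flip (C-N2-adjacency hx))
  ring-adjacency gap _ _ (inj₂ (a , hx)) (inj₂ (b , hy)) =
    reposition (ring-position-N2 hx) (ring-position-N2 hy) (N2-N2-adjacency gap hx hy)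

  partE : PartE G c
  partE gap = ring-position , (λ j → c j , inj₁ (j , refl) , ring-position-C j) , ring-adjacency gap

lemma2p1 : (G : Graph) → P5Free G → K1K3Free G →
    (c : Fin 5 → V G) → IsHole5 G c →
    ((i : Fin 5) → PartA G c i × PartB G c i × PartD G c i) ×
    PartC G c × PartE G c
lemma2p1 G p5 k13 c H = (λ i → partA i , partB i , partD i) , partC , partE
  where open Structure G p5 k13 c H
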